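{- Let $(l_n)_{n\in\mathbb{N}}$ be the increasing sequence with $\{l_n:n\in\mathbb{N}\}=\{m\in\mathbb{N}: b_m=1\}$. Then $$l_n \bmod 2=\begin{cases}0 & n=0,\\ 1 & n=1,\\ 1-\varphi_{n-2} & n\ge 2,\end{cases}$$ where $\varphi_j$ denotes the $j$-th letter (indexed from $j=0$) of the infinite Fibonacci word.
   Context: The Baum--Sweet sequence $(b_n)_{n\in\mathbb{N}}$ is defined by $b_0=1$ and, for $n\ge1$, $b_n=0$ if the binary expansion of $n$ contains a maximal block of consecutive $0$'s of odd length, and $b_n=1$ otherwise. The infinite Fibonacci word $\varphi_0\varphi_1\varphi_2\cdots=010010100100101\cdots$ is the fixed point of the monoid morphism $0\mapsto 01$, $1\mapsto 0$ on $\{0,1\}^*$. -}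

module Defs where

open import Data.Nat using (ℕ; zero; suc; _+_; _<_)
open import Data.Nat.DivMod using (_/_; _%_)
open import Data.List using (List; []; _∷_; _++_; length; concatMap)
open import Data.Bool using (Bool; true; false; _∧_; not)
open import Data.Maybe using (Maybe; just; nothing)

-- Binary digits of n, least significant first, without leading zeros.
-- (bits 0 = [], the standard binary expansion of n ≥ 1 ends in a 1.)
-- Computed with fuel k ≥ n.
bitsAux : ℕ → ℕ → List ℕ
bitsAux zero    _ = []
bitsAux (suc k) zero = []
bitsAux (suc k) (suc n) = (suc n % 2) ∷ bitsAux k (suc n / 2)

bits : ℕ → List ℕ
bits n = bitsAux n n

-- Lengths of the maximal blocks of consecutive 0's in a digit list.
-- 'cur' is the length of the block of 0's currently being read.
zeroBlocksAux : ℕ → List ℕ → List ℕ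
zeroBlocksAux zero    []            = []
zeroBlocksAux (suc c) []            = suc c ∷ []
zeroBlocksAux c       (zero ∷ ds)   = zeroBlocksAux (suc c) ds
zeroBlocksAux zero    (suc _ ∷ ds)  = zeroBlocksAux zero ds
zeroBlocksAux (suc c) (suc _ ∷ ds)  = suc c ∷ zeroBlocksAux zero ds

zeroBlocks : List ℕ → List ℕ
zeroBlocks = zeroBlocksAux zero

isEven : ℕ → Bool
isEven zero = true
isEven (suc zero) = false
isEven (suc (suc n)) = isEven n

allEven : List ℕ → Bool
allEven []       = true
allEven (x ∷ xs) = isEven x ∧ allEven xs

b2n : Bool → ℕ
b2n true  = 1
b2n false = 0

baumSweet : ℕ → ℕ
baumSweet zero    = 1
baumSweet (suc n) = b2n (allEven (zeroBlocks (bits (suc n))))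

σ-letter : ℕ → List ℕ
σ-letter zero    = 0 ∷ 1 ∷ []
σ-letter (suc _) = 0 ∷ []

σ : List ℕ → List ℕ
σ = concatMap σ-letter

σ^ : ℕ → List ℕ → List ℕ
σ^ zero    w = w
σ^ (suc k) w = σ (σ^ k w)

nth : List ℕ → ℕ → Maybe ℕ
nth []       _       = nothing
nth (x ∷ xs) zero    = just x
nth (x ∷ xs) (suc j) = nth xs j

-- j-th letter of the infinite Fibonacci word (fixed point of σ):
-- σ^k(0) is a prefix of the fixed point for every k, and |σ^j(0)| ≥ j+1,
-- so the j-th letter is the j-th letter of σ^j(0). Default 0 is never used.
fib : ℕ → ℕ
fib j with nth (σ^ j (0 ∷ [])) j
... | just x  = x
... | nothing = 0

StrictlyIncreasing : (ℕ → ℕ) → Set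
StrictlyIncreasing l = ∀ n → l n < l (suc n)

-- Write every positive integer as  val r : the number whose binary digits,
-- least significant first, are the bits r followed by the leading 1.  Its
-- Baum–Sweet value is 1 exactly when r is "good" (all maximal 0-blocks of
-- r ++ 1 have even length).  A good word of length j+2 ends either in 1 or in
-- 00, so the good words of length j are enumerated recursively as
--   goodWords (j+2) = (goodWords j)·00 ++ (goodWords (j+1))·1,
-- and this list is increasing in value.  Concatenating over lengths gives
-- goodBelow K, the increasing list of all n ∈ (0, 2^K) with b_n = 1.
--
-- A strictly increasing enumeration l of a set of naturals is unique, so
-- l (k+1) is the k-th entry of goodBelow K; and l 0 = 0.  The parity of val r
-- is its lowest bit, and the recursion above turns into the recursion
-- F (k+2) = F (k+1) ++ F k of the finite Fibonacci words F k = σ^k(0):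
-- the complemented parities of goodWords (k+1) are reverse (F k).  The
-- concatenation G (k+1) = F k ++ … ++ F 0 is a palindrome and a prefix of
-- F (k+2), which gives l (n+2) mod 2 = 1 - φ_n.
module Submission where

open import Defs
open import Data.Nat using (ℕ; zero; suc; _+_; _*_; _∸_; _^_; _≤_; _<_; z≤n; s≤s; _%_; _/_)
open import Data.Nat.Properties
open import Data.Nat.DivMod using (m%n<n; m≤n⇒m%n≡m; m/n<m; [m+kn]%n≡m%n; m*n/n≡m; +-distrib-/; m*n%n≡0)
open import Data.Nat.Tactic.RingSolver using (solve-∀)
open import Data.Bool using (Bool; true; false; _∧_)
open import Data.Bool.Properties using (∧-zeroʳ)
open import Data.List using (List; []; _∷_; _++_; _∷ʳ_; map; length; reverse)
open import Data.List.Properties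
  using (length-++; ++-assoc; map-++; length-map; map-∘; map-cong-local; reverse-++; reverse-involutive)
open import Data.List.Reverse using (Reverse; []; _∶_∶ʳ_; reverseView)
open import Data.List.Relation.Unary.All as All using (All; []; _∷_)
import Data.List.Relation.Unary.All.Properties as AllP
open import Data.List.Relation.Unary.AllPairs using (AllPairs; []; _∷_)
import Data.List.Relation.Unary.AllPairs.Properties as AllPairsP
open import Data.List.Relation.Unary.Any using (here; there)
open import Data.List.Membership.Propositional using (_∈_)
open import Data.List.Membership.Propositional.Properties using (∈-map⁺; ∈-++⁺ˡ; ∈-++⁺ʳ)
open import Data.Maybe using (just)
open import Data.Maybe.Properties using (just-injective)
open import Data.Product using (Σ; ∃; _×_; _,_; proj₁; proj₂)
open import Data.Sum using (inj₁; inj₂)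
open import Data.Empty using (⊥-elim)
open import Relation.Nullary using (yes; no)
open import Relation.Binary.PropositionalEquality

-- Binary expansions

bitsAux-fuel : ∀ f g n → n ≤ f → n ≤ g → bitsAux f n ≡ bitsAux g n
bitsAux-fuel zero    zero    zero    _       _       = refl
bitsAux-fuel zero    (suc g) zero    _       _       = refl
bitsAux-fuel (suc f) zero    zero    _       _       = refl
bitsAux-fuel (suc f) (suc g) zero    _       _       = refl
bitsAux-fuel (suc f) (suc g) (suc n) (s≤s n≤f) (s≤s n≤g) =
  cong (suc n % 2 ∷_) (bitsAux-fuel f g (suc n / 2) (≤-trans half≤n n≤f) (≤-trans half≤n n≤g))
  where
  half≤n : suc n / 2 ≤ n
  half≤n = <⇒≤pred (m/n<m (suc n) 2 (s≤s (s≤s z≤n)))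

bits-step : ∀ m → 0 < m → bits m ≡ m % 2 ∷ bits (m / 2)
bits-step (suc m) _ = cong (suc m % 2 ∷_)
  (bitsAux-fuel m (suc m / 2) (suc m / 2) (<⇒≤pred (m/n<m (suc m) 2 (s≤s (s≤s z≤n)))) ≤-refl)

b2n≤1 : ∀ b → b2n b ≤ 1
b2n≤1 true  = ≤-refl
b2n≤1 false = z≤n

b2n-mod2 : ∀ b k → (b2n b + 2 * k) % 2 ≡ b2n b
b2n-mod2 b k = begin
  (b2n b + 2 * k) % 2  ≡⟨ cong (λ x → (b2n b + x) % 2) (*-comm 2 k) ⟩
  (b2n b + k * 2) % 2  ≡⟨ [m+kn]%n≡m%n (b2n b) k 2 ⟩
  b2n b % 2            ≡⟨ m≤n⇒m%n≡m (b2n≤1 b) ⟩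
  b2n b                ∎
  where open ≡-Reasoning

b2n-div2 : ∀ b k → (b2n b + 2 * k) / 2 ≡ k
b2n-div2 false k = trans (cong (_/ 2) (*-comm 2 k)) (m*n/n≡m k 2)
b2n-div2 true  k = begin
  (1 + 2 * k) / 2      ≡⟨ cong (λ x → (1 + x) / 2) (*-comm 2 k) ⟩
  (1 + k * 2) / 2      ≡⟨ +-distrib-/ 1 (k * 2) no-carry ⟩
  0 + (k * 2) / 2      ≡⟨ m*n/n≡m k 2 ⟩
  k                    ∎
  where
  open ≡-Reasoning
  no-carry : 1 % 2 + (k * 2) % 2 < 2
  no-carry = subst (λ x → 1 + x < 2) (sym (m*n%n≡0 k 2)) (s≤s (s≤s z≤n))

-- val r is the number with binary digits r ++ [1], least significant first.
val : List Bool → ℕ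
val []      = 1
val (b ∷ r) = b2n b + 2 * val r

val-positive : ∀ r → 0 < val r
val-positive []      = s≤s z≤n
val-positive (b ∷ r) = <-≤-trans (val-positive r) (≤-trans (m≤n*m (val r) 2) (m≤n+m (2 * val r) (b2n b)))

bits-val : ∀ r → bits (val r) ≡ map b2n r ++ 1 ∷ []
bits-val []      = refl
bits-val (b ∷ r) = trans (bits-step (val (b ∷ r)) (val-positive (b ∷ r)))
  (cong₂ _∷_ (b2n-mod2 b (val r)) (trans (cong bits (b2n-div2 b (val r))) (bits-val r)))

good : List Bool → Bool
good r = allEven (zeroBlocks (map b2n r ++ 1 ∷ []))

baumSweet-val : ∀ r → baumSweet (val r) ≡ b2n (good r)
baumSweet-val r = trans (unfold (val r) (val-positive r))
  (cong (λ ds → b2n (allEven (zeroBlocks ds))) (bits-val r))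
  where
  unfold : ∀ m → 0 < m → baumSweet m ≡ b2n (allEven (zeroBlocks (bits m)))
  unfold (suc m) _ = refl

increment : List Bool → List Bool
increment []          = false ∷ []
increment (false ∷ r) = true ∷ r
increment (true ∷ r)  = false ∷ increment r

val-increment : ∀ r → val (increment r) ≡ suc (val r)
val-increment []          = refl
val-increment (false ∷ r) = refl
val-increment (true ∷ r)  = trans (cong (2 *_) (val-increment r)) (double-suc (val r))
  where
  double-suc : ∀ x → 2 * suc x ≡ suc (1 + 2 * x)
  double-suc = solve-∀

val-surjective : ∀ m → Σ (List Bool) (λ r → val r ≡ suc m)
val-surjective zero    = [] , refl
val-surjective (suc m) with val-surjective m
... | r , e = increment r , trans (val-increment r) (cong suc e)

val-lower : ∀ r → 2 ^ length r ≤ val r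
val-lower []      = ≤-refl
val-lower (b ∷ r) = ≤-trans (*-monoʳ-≤ 2 (val-lower r)) (m≤n+m (2 * val r) (b2n b))

val-upper : ∀ r → val r < 2 * 2 ^ length r
val-upper []      = s≤s (s≤s z≤n)
val-upper (b ∷ r) = ≤-trans (+-monoˡ-≤ (2 * val r) (s≤s (b2n≤1 b)))
  (subst (_≤ 2 * (2 * 2 ^ length r)) (double-suc (val r)) (*-monoʳ-≤ 2 (val-upper r)))
  where
  double-suc : ∀ x → 2 * suc x ≡ 2 + 2 * x
  double-suc = solve-∀

ff tt : List Bool
ff = false ∷ false ∷ []
tt = true ∷ []

val-++00 : ∀ r → val (r ++ ff) ≡ val r + 3 * 2 ^ length r
val-++00 []      = refl
val-++00 (b ∷ r) = trans (cong (λ x → b2n b + 2 * x) (val-++00 r)) (distrib (b2n b) (val r) (2 ^ length r))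
  where
  distrib : ∀ a x p → a + 2 * (x + 3 * p) ≡ a + 2 * x + 3 * (2 * p)
  distrib = solve-∀

val-++1 : ∀ r → val (r ++ tt) ≡ val r + 2 * 2 ^ length r
val-++1 []      = refl
val-++1 (b ∷ r) = trans (cong (λ x → b2n b + 2 * x) (val-++1 r)) (distrib (b2n b) (val r) (2 ^ length r))
  where
  distrib : ∀ a x p → a + 2 * (x + 2 * p) ≡ a + 2 * x + 2 * (2 * p)
  distrib = solve-∀

zeroBlocks-++1 : ∀ c r → zeroBlocksAux c (map b2n (r ++ tt) ++ 1 ∷ []) ≡ zeroBlocksAux c (map b2n r ++ 1 ∷ [])
zeroBlocks-++1 zero    []          = refl
zeroBlocks-++1 (suc c) []          = refl
zeroBlocks-++1 zero    (false ∷ r) = zeroBlocks-++1 1 r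
zeroBlocks-++1 (suc c) (false ∷ r) = zeroBlocks-++1 (suc (suc c)) r
zeroBlocks-++1 zero    (true ∷ r)  = zeroBlocks-++1 zero r
zeroBlocks-++1 (suc c) (true ∷ r)  = cong (suc c ∷_) (zeroBlocks-++1 zero r)

allEven-++00 : ∀ c r → allEven (zeroBlocksAux c (map b2n (r ++ ff) ++ 1 ∷ [])) ≡ allEven (zeroBlocksAux c (map b2n r ++ 1 ∷ []))
allEven-++00 zero    []          = refl
allEven-++00 (suc c) []          = refl
allEven-++00 zero    (false ∷ r) = allEven-++00 1 r
allEven-++00 (suc c) (false ∷ r) = allEven-++00 (suc (suc c)) r
allEven-++00 zero    (true ∷ r)  = allEven-++00 zero r
allEven-++00 (suc c) (true ∷ r)  = cong (isEven (suc c) ∧_) (allEven-++00 zero r)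

allEven-++10 : ∀ c r → allEven (zeroBlocksAux c (map b2n (r ++ true ∷ false ∷ []) ++ 1 ∷ [])) ≡ false
allEven-++10 zero    []          = refl
allEven-++10 (suc c) []          = ∧-zeroʳ (isEven (suc c))
allEven-++10 zero    (false ∷ r) = allEven-++10 1 r
allEven-++10 (suc c) (false ∷ r) = allEven-++10 (suc (suc c)) r
allEven-++10 zero    (true ∷ r)  = allEven-++10 zero r
allEven-++10 (suc c) (true ∷ r)  = trans (cong (isEven (suc c) ∧_) (allEven-++10 zero r)) (∧-zeroʳ _)

good-++1 : ∀ r → good (r ++ tt) ≡ good r
good-++1 r = cong allEven (zeroBlocks-++1 0 r)

good-++00 : ∀ r → good (r ++ ff) ≡ good r
good-++00 r = allEven-++00 0 r

good-++10 : ∀ r → good (r ++ true ∷ false ∷ []) ≡ false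
good-++10 r = allEven-++10 0 r

goodWords : ℕ → List (List Bool)
goodWords zero          = [] ∷ []
goodWords (suc zero)    = tt ∷ []
goodWords (suc (suc j)) = map (_++ ff) (goodWords j) ++ map (_++ tt) (goodWords (suc j))

GoodOfLength : ℕ → List Bool → Set
GoodOfLength j r = length r ≡ j × good r ≡ true

length-++-≡ : ∀ (r s : List Bool) {j} → length r ≡ j → length (r ++ s) ≡ j + length s
length-++-≡ r s e = trans (length-++ r) (cong (_+ length s) e)

goodWords-sound : ∀ j → All (GoodOfLength j) (goodWords j)
goodWords-sound zero          = (refl , refl) ∷ []
goodWords-sound (suc zero)    = (refl , refl) ∷ []
goodWords-sound (suc (suc j)) =
  AllP.++⁺ (AllP.map⁺ (All.map (λ {r} → extend00 r) (goodWords-sound j)))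
           (AllP.map⁺ (All.map (λ {r} → extend1 r) (goodWords-sound (suc j))))
  where
  extend00 : ∀ r → GoodOfLength j r → GoodOfLength (suc (suc j)) (r ++ ff)
  extend00 r (e , g) = trans (length-++-≡ r ff e) (+-comm j 2) , trans (good-++00 r) g
  extend1 : ∀ r → GoodOfLength (suc j) r → GoodOfLength (suc (suc j)) (r ++ tt)
  extend1 r (e , g) = trans (length-++-≡ r tt e) (+-comm (suc j) 1) , trans (good-++1 r) g

length-∷ʳ : ∀ (r : List Bool) b → length (r ∷ʳ b) ≡ suc (length r)
length-∷ʳ r b = trans (length-++ r) (+-comm (length r) 1)

length-∷ʳ-pred : ∀ (r : List Bool) b {j} → length (r ∷ʳ b) ≡ suc j → length r ≡ j
length-∷ʳ-pred r b e = suc-injective (trans (sym (length-∷ʳ r b)) e)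

goodWords-complete : ∀ j r → length r ≡ j → good r ≡ true → r ∈ goodWords j
goodWords-complete j r = complete j (reverseView r)
  where
  complete : ∀ j {r} → Reverse r → length r ≡ j → good r ≡ true → r ∈ goodWords j
  complete zero          []                         _ _ = here refl
  complete (suc j)       []                         () _
  complete zero          (r ∶ _ ∶ʳ b)               e _ = ⊥-elim (1+n≢0 (trans (sym (length-∷ʳ r b)) e))
  complete (suc zero)    (_ ∶ [] ∶ʳ true)           _ _ = here refl
  complete (suc zero)    (_ ∶ [] ∶ʳ false)          _ ()
  complete (suc zero)    (_ ∶ (s ∶ _ ∶ʳ c) ∶ʳ b)    e _ =
    ⊥-elim (1+n≢0 (trans (sym (length-∷ʳ s c)) (length-∷ʳ-pred (s ∷ʳ c) b e)))
  complete (suc (suc j)) (r ∶ v ∶ʳ true)            e g =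
    ∈-++⁺ʳ _ (∈-map⁺ (_++ tt) (complete (suc j) v (length-∷ʳ-pred r true e) (trans (sym (good-++1 r)) g)))
  complete (suc (suc j)) (_ ∶ [] ∶ʳ false)          () _
  complete (suc (suc j)) (_ ∶ (s ∶ v ∶ʳ false) ∶ʳ false) e g =
    subst (_∈ goodWords (suc (suc j))) (sym top00)
      (∈-++⁺ˡ (∈-map⁺ (_++ ff) (complete j v (length-∷ʳ-pred s false (length-∷ʳ-pred (s ∷ʳ false) false e))
                                             (trans (sym (good-++00 s)) (subst (λ w → good w ≡ true) top00 g)))))
    where
    top00 : (s ∷ʳ false) ∷ʳ false ≡ s ++ ff
    top00 = ++-assoc s (false ∷ []) (false ∷ [])
  complete (suc (suc j)) (_ ∶ (s ∶ v ∶ʳ true) ∶ʳ false) e g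
    with trans (sym (subst (λ w → good w ≡ true) (++-assoc s (true ∷ []) (false ∷ [])) g)) (good-++10 s)
  ... | ()

AllPairs-with : ∀ {A : Set} {P : A → Set} {R S : A → A → Set} {xs : List A} →
  (∀ {x y} → P x → P y → R x y → S x y) → All P xs → AllPairs R xs → AllPairs S xs
AllPairs-with {P = P} {R} {S} f []         []         = []
AllPairs-with {P = P} {R} {S} f (px ∷ pxs) (rx ∷ rxs) = lift px pxs rx ∷ AllPairs-with f pxs rxs
  where
  lift : ∀ {x ys} → P x → All P ys → All (R x) ys → All (S x) ys
  lift px []         []         = []
  lift px (py ∷ pys) (r ∷ rs)   = f px py r ∷ lift px pys rs

ValueLess : List Bool → List Bool → Set
ValueLess r r' = val r < val r'

val-++00<val-++1 : ∀ j r r' → length r ≡ j → length r' ≡ suc j → val (r ++ ff) < val (r' ++ tt)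
val-++00<val-++1 j r r' e e' = begin-strict
  val (r ++ ff)           ≡⟨ val-++00 r ⟩
  val r + 3 * 2 ^ length r ≡⟨ cong (λ k → val r + 3 * 2 ^ k) e ⟩
  val r + 3 * p           <⟨ +-monoˡ-< (3 * p) (subst (λ k → val r < 2 * 2 ^ k) e (val-upper r)) ⟩
  2 * p + 3 * p           ≤⟨ +-monoʳ-≤ (2 * p) (subst (3 * p ≤_) (four p) (*-monoˡ-≤ p {3} {4} (s≤s (s≤s (s≤s z≤n))))) ⟩
  2 * p + 2 * (2 * p)     ≤⟨ +-monoˡ-≤ (2 * (2 * p)) (subst (λ k → 2 ^ k ≤ val r') e' (val-lower r')) ⟩
  val r' + 2 * (2 * p)    ≡⟨ cong (λ k → val r' + 2 * 2 ^ k) (sym e') ⟩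
  val r' + 2 * 2 ^ length r' ≡⟨ sym (val-++1 r') ⟩
  val (r' ++ tt)          ∎
  where
  open ≤-Reasoning
  p : ℕ
  p = 2 ^ j
  four : ∀ q → 4 * q ≡ 2 * (2 * q)
  four = solve-∀

goodWords-sorted : ∀ j → AllPairs ValueLess (goodWords j)
goodWords-sorted zero          = [] ∷ []
goodWords-sorted (suc zero)    = [] ∷ []
goodWords-sorted (suc (suc j)) = AllPairsP.++⁺
  (AllPairsP.map⁺ (AllPairs-with (λ {r} {r'} → extend ff 3 val-++00 {r} {r'}) (goodWords-sound j) (goodWords-sorted j)))
  (AllPairsP.map⁺ (AllPairs-with (λ {r} {r'} → extend tt 2 val-++1 {r} {r'}) (goodWords-sound (suc j)) (goodWords-sorted (suc j))))
  (AllP.map⁺ (All.map (λ {r} g → AllP.map⁺ (All.map (λ {r'} g' → val-++00<val-++1 j r r' (proj₁ g) (proj₁ g'))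
                                                     (goodWords-sound (suc j))))
                      (goodWords-sound j)))
  where
  extend : ∀ s k {n} → (∀ r → val (r ++ s) ≡ val r + k * 2 ^ length r) →
           ∀ {r r'} → GoodOfLength n r → GoodOfLength n r' → ValueLess r r' → ValueLess (r ++ s) (r' ++ s)
  extend s k {n} val-++ {r} {r'} (e , _) (e' , _) lt
    rewrite val-++ r | val-++ r' | e | e' = +-monoˡ-< (k * 2 ^ n) lt

goodBelow : ℕ → List ℕ
goodBelow zero    = []
goodBelow (suc K) = goodBelow K ++ map val (goodWords K)

GoodBelow : ℕ → ℕ → Set
GoodBelow K z = 0 < z × z < 2 ^ K × baumSweet z ≡ 1

baumSweet-good : ∀ r → good r ≡ true → baumSweet (val r) ≡ 1
baumSweet-good r g = trans (baumSweet-val r) (cong b2n g)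

goodBelow-inRange : ∀ K → All (GoodBelow K) (goodBelow K)
goodBelow-inRange zero    = []
goodBelow-inRange (suc K) = AllP.++⁺
  (All.map (λ { (pos , lt , bs) → pos , <-≤-trans lt (m≤m+n (2 ^ K) _) , bs }) (goodBelow-inRange K))
  (AllP.map⁺ (All.map (λ {r} g → val-positive r , subst (λ k → val r < 2 * 2 ^ k) (proj₁ g) (val-upper r)
                                 , baumSweet-good r (proj₂ g))
                      (goodWords-sound K)))

goodBelow-sorted : ∀ K → AllPairs _<_ (goodBelow K)
goodBelow-sorted zero    = []
goodBelow-sorted (suc K) = AllPairsP.++⁺ (goodBelow-sorted K) (AllPairsP.map⁺ (goodWords-sorted K))
  (All.map (λ { (_ , lt , _) → AllP.map⁺ (All.map (λ {r} g → <-≤-trans lt (subst (λ k → 2 ^ k ≤ val r) (proj₁ g) (val-lower r)))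
                                                  (goodWords-sound K)) })
           (goodBelow-inRange K))

val-goodBelow : ∀ K r → length r < K → good r ≡ true → val r ∈ goodBelow K
val-goodBelow (suc K) r (s≤s le) g with m≤n⇒m<n∨m≡n le
... | inj₁ lt = ∈-++⁺ˡ (val-goodBelow K r lt g)
... | inj₂ e  = ∈-++⁺ʳ (goodBelow K) (∈-map⁺ val (goodWords-complete K r e g))

b2n≡1 : ∀ b → b2n b ≡ 1 → b ≡ true
b2n≡1 true  _ = refl
b2n≡1 false ()

goodBelow-complete : ∀ K z → baumSweet z ≡ 1 → 0 < z → z < 2 ^ K → z ∈ goodBelow K
goodBelow-complete K (suc m) bs _ lt with val-surjective m
... | r , e with length r <? K
...   | yes short = subst (_∈ goodBelow K) e
                      (val-goodBelow K r short (b2n≡1 (good r) (trans (sym (baumSweet-val r)) (trans (cong baumSweet e) bs))))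
...   | no long   = ⊥-elim (<-irrefl refl (<-≤-trans lt
                      (≤-trans (^-monoʳ-≤ 2 (≮⇒≥ long)) (subst (2 ^ length r ≤_) e (val-lower r)))))

goodWords-nonempty : ∀ j → 1 ≤ length (goodWords j)
goodWords-nonempty zero          = s≤s z≤n
goodWords-nonempty (suc zero)    = s≤s z≤n
goodWords-nonempty (suc (suc j)) = ≤-trans (goodWords-nonempty (suc j)) (begin
  length (goodWords (suc j))                                ≡⟨ sym (length-map (_++ tt) (goodWords (suc j))) ⟩
  length (map (_++ tt) (goodWords (suc j)))                 ≤⟨ m≤n+m _ _ ⟩
  length (map (_++ ff) (goodWords j)) + length (map (_++ tt) (goodWords (suc j))) ≡⟨ sym (length-++ (map (_++ ff) (goodWords j))) ⟩
  length (goodWords (suc (suc j)))                          ∎)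
  where open ≤-Reasoning

goodBelow-length : ∀ K → K ≤ length (goodBelow K)
goodBelow-length zero    = z≤n
goodBelow-length (suc K) = begin
  suc K                                             ≡⟨ +-comm 1 K ⟩
  K + 1                                             ≤⟨ +-mono-≤ (goodBelow-length K) (goodWords-nonempty K) ⟩
  length (goodBelow K) + length (goodWords K)       ≡⟨ cong (length (goodBelow K) +_) (sym (length-map val (goodWords K))) ⟩
  length (goodBelow K) + length (map val (goodWords K)) ≡⟨ sym (length-++ (goodBelow K)) ⟩
  length (goodBelow (suc K))                        ∎
  where open ≤-Reasoning

module Between (P : ℕ → Set) where

  Next : ℕ → ℕ → Set
  Next x y = x < y × P y × (∀ z → P z → x < z → y ≤ z)

  record SortedBetween (x B : ℕ) (xs : List ℕ) : Set where
    field
      above  : All (x <_) xs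
      sorted : AllPairs _<_ xs
      inside : All (λ z → z < B × P z) xs
      covers : ∀ z → P z → x < z → z < B → z ∈ xs

  head-next : ∀ {x B y ys} → SortedBetween x B (y ∷ ys) → Next x y
  head-next {x} {B} {y} {ys} record { above = x<y ∷ _ ; sorted = y<ys ∷ _ ; inside = (y<B , py) ∷ _ ; covers = covers } =
    x<y , py , least
    where
    least : ∀ z → P z → x < z → y ≤ z
    least z pz x<z with z <? B
    ... | no  z≮B = ≤-trans (<⇒≤ y<B) (≮⇒≥ z≮B)
    ... | yes z<B with covers z pz x<z z<B
    ...   | here refl = ≤-refl
    ...   | there z∈ys = <⇒≤ (All.lookup y<ys z∈ys)

  tail-between : ∀ {x B y ys} → SortedBetween x B (y ∷ ys) → SortedBetween y B ys
  tail-between {x} {B} {y} {ys} record { above = x<y ∷ _ ; sorted = y<ys ∷ ys-sorted ; inside = _ ∷ ys-inside ; covers = covers } =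
    record { above = y<ys ; sorted = ys-sorted ; inside = ys-inside ; covers = covers′ }
    where
    covers′ : ∀ z → P z → y < z → z < B → z ∈ ys
    covers′ z pz y<z z<B with covers z pz (<-trans x<y y<z) z<B
    ... | here refl  = ⊥-elim (<-irrefl refl y<z)
    ... | there z∈ys = z∈ys

-- A strictly increasing enumeration of a set of naturals is unique

module Enumeration (P : ℕ → Set) (l : ℕ → ℕ) (increasing : StrictlyIncreasing l)
                   (onto : ∀ m → P m → ∃ λ n → l n ≡ m) (into : ∀ n → P (l n)) where

  open Between P

  monotone-+ : ∀ i k → l i ≤ l (k + i)
  monotone-+ i zero    = ≤-refl
  monotone-+ i (suc k) = ≤-trans (monotone-+ i k) (<⇒≤ (increasing (k + i)))

  monotone : ∀ {i j} → i ≤ j → l i ≤ l j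
  monotone {i} {j} i≤j = subst (λ n → l i ≤ l n) (m∸n+n≡m i≤j) (monotone-+ i (j ∸ i))

  l0-least : ∀ m → P m → l 0 ≤ m
  l0-least m pm with onto m pm
  ... | n , refl = monotone z≤n

  next-value : ∀ i {x y} → l i ≡ x → Next x y → l (suc i) ≡ y
  next-value i {x} {y} li≡x (x<y , py , least) with onto y py
  ... | j , lj≡y with suc i ≤? j
  ...   | yes i<j = ≤-antisym (subst (l (suc i) ≤_) lj≡y (monotone i<j))
                              (least (l (suc i)) (into (suc i)) (subst (_< l (suc i)) li≡x (increasing i)))
  ...   | no  i≮j = ⊥-elim (<-irrefl refl (≤-<-trans (subst₂ _≤_ lj≡y li≡x (monotone (≮⇒≥ i≮j))) x<y))

  enumerates : ∀ {x B xs} i → l i ≡ x → SortedBetween x B xs → ∀ k {v} → nth xs k ≡ just v → l (suc (i + k)) ≡ v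
  enumerates {xs = y ∷ ys} i li≡x between zero refl =
    trans (cong (λ n → l (suc n)) (+-identityʳ i)) (next-value i li≡x (head-next between))
  enumerates {xs = y ∷ ys} i li≡x between (suc k) nth≡v =
    trans (cong (λ n → l (suc n)) (+-suc i k))
          (enumerates (suc i) (next-value i li≡x (head-next between)) (tail-between between) k nth≡v)

-- Finite Fibonacci words

F : ℕ → List ℕ
F k = σ^ k (0 ∷ [])

σ-++ : ∀ xs ys → σ (xs ++ ys) ≡ σ xs ++ σ ys
σ-++ []       ys = refl
σ-++ (x ∷ xs) ys = trans (cong (σ-letter x ++_) (σ-++ xs ys)) (sym (++-assoc (σ-letter x) (σ xs) (σ ys)))

F-split : ∀ k → F (suc (suc k)) ≡ F (suc k) ++ F k
F-split zero    = refl
F-split (suc k) = trans (cong σ (F-split k)) (σ-++ (F (suc k)) (F k))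

G : ℕ → List ℕ
G zero    = []
G (suc k) = F k ++ G k

-- The last two letters of F (k+1): 01 for even k, 10 for odd k.
lastTwo : ℕ → List ℕ
lastTwo zero          = 0 ∷ 1 ∷ []
lastTwo (suc zero)    = 1 ∷ 0 ∷ []
lastTwo (suc (suc k)) = lastTwo k

reverse-lastTwo : ∀ k → reverse (lastTwo k) ≡ lastTwo (suc k)
reverse-lastTwo zero          = refl
reverse-lastTwo (suc zero)    = refl
reverse-lastTwo (suc (suc k)) = reverse-lastTwo k

F-prefix : ∀ k → F (suc k) ≡ G k ++ lastTwo k
F-prefix zero          = refl
F-prefix (suc zero)    = refl
F-prefix (suc (suc k)) = begin
  F (suc (suc (suc k)))                               ≡⟨ F-split (suc k) ⟩
  F (suc (suc k)) ++ F (suc k)                        ≡⟨ cong₂ _++_ (F-split k) (F-prefix k) ⟩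
  (F (suc k) ++ F k) ++ (G k ++ lastTwo k)            ≡⟨ ++-assoc (F (suc k)) (F k) (G k ++ lastTwo k) ⟩
  F (suc k) ++ (F k ++ (G k ++ lastTwo k))            ≡⟨ cong (F (suc k) ++_) (sym (++-assoc (F k) (G k) (lastTwo k))) ⟩
  F (suc k) ++ (G (suc k) ++ lastTwo k)               ≡⟨ sym (++-assoc (F (suc k)) (G (suc k)) (lastTwo k)) ⟩
  G (suc (suc k)) ++ lastTwo (suc (suc k))            ∎
  where open ≡-Reasoning

palindrome-sandwich : ∀ (a b c d : List ℕ) → reverse a ≡ a → reverse c ≡ c → reverse b ≡ d →
  reverse ((a ++ b) ++ ((c ++ d) ++ a)) ≡ (a ++ b) ++ ((c ++ d) ++ a)
palindrome-sandwich a b c d ra rc rb = begin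
  reverse ((a ++ b) ++ ((c ++ d) ++ a))                ≡⟨ reverse-++ (a ++ b) ((c ++ d) ++ a) ⟩
  reverse ((c ++ d) ++ a) ++ reverse (a ++ b)          ≡⟨ cong₂ _++_ (reverse-++ (c ++ d) a) (reverse-++ a b) ⟩
  (reverse a ++ reverse (c ++ d)) ++ (reverse b ++ reverse a)
    ≡⟨ cong₂ (λ u v → (u ++ v) ++ (reverse b ++ u)) ra (reverse-++ c d) ⟩
  (a ++ (reverse d ++ reverse c)) ++ (reverse b ++ a)  ≡⟨ cong₂ (λ u v → (a ++ u) ++ (v ++ a)) (cong₂ _++_ rd rc) rb ⟩
  (a ++ (b ++ c)) ++ (d ++ a)                          ≡⟨ ++-assoc a (b ++ c) (d ++ a) ⟩
  a ++ ((b ++ c) ++ (d ++ a))                          ≡⟨ cong (a ++_) (++-assoc b c (d ++ a)) ⟩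
  a ++ (b ++ (c ++ (d ++ a)))                          ≡⟨ cong (λ u → a ++ (b ++ u)) (sym (++-assoc c d a)) ⟩
  a ++ (b ++ ((c ++ d) ++ a))                          ≡⟨ sym (++-assoc a b ((c ++ d) ++ a)) ⟩
  (a ++ b) ++ ((c ++ d) ++ a)                          ∎
  where
  open ≡-Reasoning
  rd : reverse d ≡ b
  rd = trans (cong reverse (sym rb)) (reverse-involutive b)

G-palindrome : ∀ k → reverse (G k) ≡ G k
G-palindrome zero                = refl
G-palindrome (suc zero)          = refl
G-palindrome (suc (suc zero))    = refl
G-palindrome (suc (suc (suc k))) =
  trans (cong reverse unfold)
        (trans (palindrome-sandwich (G (suc k)) (lastTwo (suc k)) (G k) (lastTwo k)
                                    (G-palindrome (suc k)) (G-palindrome k) (reverse-lastTwo (suc k)))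
               (sym unfold))
  where
  unfold : G (suc (suc (suc k))) ≡ (G (suc k) ++ lastTwo (suc k)) ++ ((G k ++ lastTwo k) ++ G (suc k))
  unfold = cong₂ (λ u v → u ++ (v ++ G (suc k))) (F-prefix (suc k)) (F-prefix k)

-- Parities of the good words follow the Fibonacci recursion

parity : List Bool → ℕ
parity r = val r % 2

-- The parity is the lowest digit, untouched by appending digits on top.
parity-++ : ∀ {n} r s → length r ≡ suc n → parity (r ++ s) ≡ parity r
parity-++ (b ∷ r) s _ = trans (b2n-mod2 b (val (r ++ s))) (sym (b2n-mod2 b (val r)))

parities : ℕ → List ℕ
parities j = map parity (goodWords j)

parities-extend : ∀ j s → map parity (map (_++ s) (goodWords (suc j))) ≡ parities (suc j)
parities-extend j s = trans (sym (map-∘ (goodWords (suc j))))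
  (map-cong-local (All.map (λ {r} g → parity-++ r s (proj₁ g)) (goodWords-sound (suc j))))

parities-rec : ∀ j → parities (suc (suc (suc j))) ≡ parities (suc j) ++ parities (suc (suc j))
parities-rec j = trans (map-++ parity (map (_++ ff) (goodWords (suc j))) (map (_++ tt) (goodWords (suc (suc j)))))
  (cong₂ _++_ (parities-extend j ff) (parities-extend (suc j) tt))

complement : List ℕ → List ℕ
complement = map (1 ∸_)

complement-parities : ∀ k → complement (parities (suc k)) ≡ reverse (F k)
complement-parities zero          = refl
complement-parities (suc zero)    = refl
complement-parities (suc (suc k)) = begin
  complement (parities (suc (suc (suc k))))                         ≡⟨ cong complement (parities-rec k) ⟩
  complement (parities (suc k) ++ parities (suc (suc k)))           ≡⟨ map-++ (1 ∸_) (parities (suc k)) (parities (suc (suc k))) ⟩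
  complement (parities (suc k)) ++ complement (parities (suc (suc k))) ≡⟨ cong₂ _++_ (complement-parities k) (complement-parities (suc k)) ⟩
  reverse (F k) ++ reverse (F (suc k))                              ≡⟨ sym (reverse-++ (F (suc k)) (F k)) ⟩
  reverse (F (suc k) ++ F k)                                        ≡⟨ cong reverse (sym (F-split k)) ⟩
  reverse (F (suc (suc k)))                                         ∎
  where open ≡-Reasoning

allParities : ℕ → List ℕ
allParities zero    = []
allParities (suc K) = allParities K ++ parities (suc K)

goodBelow-parities : ∀ K → map (_% 2) (goodBelow (suc K)) ≡ 1 ∷ allParities K
goodBelow-parities zero    = refl
goodBelow-parities (suc K) =
  trans (map-++ (_% 2) (goodBelow (suc K)) (map val (goodWords (suc K))))
        (cong₂ _++_ (goodBelow-parities K) (sym (map-∘ (goodWords (suc K)))))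

complement-allParities : ∀ K → complement (allParities K) ≡ G K
complement-allParities zero    = refl
complement-allParities (suc K) = begin
  complement (allParities K ++ parities (suc K))               ≡⟨ map-++ (1 ∸_) (allParities K) (parities (suc K)) ⟩
  complement (allParities K) ++ complement (parities (suc K))  ≡⟨ cong₂ _++_ (complement-allParities K) (complement-parities K) ⟩
  G K ++ reverse (F K)                                         ≡⟨ cong (_++ reverse (F K)) (sym (G-palindrome K)) ⟩
  reverse (G K) ++ reverse (F K)                               ≡⟨ sym (reverse-++ (F K) (G K)) ⟩
  reverse (G (suc K))                                          ≡⟨ G-palindrome (suc K) ⟩
  G (suc K)                                                    ∎
  where open ≡-Reasoning

nth-++ˡ : ∀ (xs ys : List ℕ) i {v} → nth xs i ≡ just v → nth (xs ++ ys) i ≡ just v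
nth-++ˡ (x ∷ xs) ys zero    e = e
nth-++ˡ (x ∷ xs) ys (suc i) e = nth-++ˡ xs ys i e

nth-defined : ∀ (xs : List ℕ) i → i < length xs → ∃ λ v → nth xs i ≡ just v
nth-defined (x ∷ xs) zero    _         = x , refl
nth-defined (x ∷ xs) (suc i) (s≤s i<n) = nth-defined xs i i<n

nth-map : ∀ (f : ℕ → ℕ) xs i {v} → nth xs i ≡ just v → nth (map f xs) i ≡ just (f v)
nth-map f (x ∷ xs) zero    refl = refl
nth-map f (x ∷ xs) (suc i) e    = nth-map f xs i e

F-step : ∀ k i {v} → nth (F k) i ≡ just v → nth (F (suc k)) i ≡ just v
F-step zero    i e = nth-++ˡ (F zero) (1 ∷ []) i e
F-step (suc k) i e = subst (λ w → nth w i ≡ just _) (sym (F-split k)) (nth-++ˡ (F (suc k)) (F k) i e)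

F-extend : ∀ d k i {v} → nth (F k) i ≡ just v → nth (F (d + k)) i ≡ just v
F-extend zero    k i e = e
F-extend (suc d) k i e = F-step (d + k) i (F-extend d k i e)

F-length : ∀ k → suc k ≤ length (F k)
F-length zero          = s≤s z≤n
F-length (suc zero)    = s≤s (s≤s z≤n)
F-length (suc (suc k)) = begin
  suc (suc (suc k))                     ≤⟨ s≤s (s≤s (m≤n+m (suc k) k)) ⟩
  suc (suc k) + suc k                   ≤⟨ +-mono-≤ (F-length (suc k)) (F-length k) ⟩
  length (F (suc k)) + length (F k)     ≡⟨ sym (length-++ (F (suc k))) ⟩
  length (F (suc k) ++ F k)             ≡⟨ cong length (sym (F-split k)) ⟩
  length (F (suc (suc k)))              ∎
  where open ≤-Reasoning

fib-unfold : ∀ n {v} → nth (F n) n ≡ just v → fib n ≡ v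
fib-unfold n e with nth (σ^ n (0 ∷ [])) n | e
... | just _ | refl = refl

fib-from-prefix : ∀ d n {v} → nth (F (d + n)) n ≡ just v → fib n ≡ v
fib-from-prefix d n e with nth-defined (F n) n (F-length n)
... | w , ew = trans (fib-unfold n ew) (just-injective (trans (sym (F-extend d n n ew)) e))

open Between (λ m → baumSweet m ≡ 1) using (SortedBetween)

goodBelow-between : ∀ K → SortedBetween 0 (2 ^ K) (goodBelow K)
goodBelow-between K = record
  { above  = All.map proj₁ (goodBelow-inRange K)
  ; sorted = goodBelow-sorted K
  ; inside = All.map proj₂ (goodBelow-inRange K)
  ; covers = goodBelow-complete K
  }

1∸1∸bit : ∀ x → x ≤ 1 → 1 ∸ (1 ∸ x) ≡ x
1∸1∸bit zero          _ = refl
1∸1∸bit (suc zero)    _ = refl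
1∸1∸bit (suc (suc x)) (s≤s ())

goodBelow-parity : ∀ n {v} → nth (goodBelow (suc (suc n))) (suc n) ≡ just v → v % 2 ≡ 1 ∸ fib n
goodBelow-parity n {v} e = begin
  v % 2              ≡⟨ sym (1∸1∸bit (v % 2) (≤-pred (m%n<n v 2))) ⟩
  1 ∸ (1 ∸ v % 2)    ≡⟨ cong (1 ∸_) (sym (fib-from-prefix 2 n inF)) ⟩
  1 ∸ fib n          ∎
  where
  open ≡-Reasoning
  inParities : nth (allParities (suc n)) n ≡ just (v % 2)
  inParities = subst (λ xs → nth xs (suc n) ≡ just (v % 2)) (goodBelow-parities (suc n))
                     (nth-map (_% 2) (goodBelow (suc (suc n))) (suc n) e)
  inG : nth (G (suc n)) n ≡ just (1 ∸ v % 2)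
  inG = subst (λ xs → nth xs n ≡ just (1 ∸ v % 2)) (complement-allParities (suc n))
              (nth-map (1 ∸_) (allParities (suc n)) n inParities)
  inF : nth (F (2 + n)) n ≡ just (1 ∸ v % 2)
  inF = subst (λ xs → nth xs n ≡ just (1 ∸ v % 2)) (sym (F-prefix (suc n)))
              (nth-++ˡ (G (suc n)) (lastTwo (suc n)) n inG)

mainTheorem3 : (l : ℕ → ℕ) → StrictlyIncreasing l →
    (∀ m → baumSweet m ≡ 1 → ∃ λ n → l n ≡ m) →
    (∀ n → baumSweet (l n) ≡ 1) →
    (l 0 % 2 ≡ 0) × (l 1 % 2 ≡ 1) × (∀ n → l (suc (suc n)) % 2 ≡ 1 ∸ fib n)
mainTheorem3 l increasing onto into = cong (_% 2) l0≡0 , cong (_% 2) (l-goodBelow 1 0 refl) , parity-step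
  where
  open Enumeration (λ m → baumSweet m ≡ 1) l increasing onto into
  l0≡0 : l 0 ≡ 0
  l0≡0 = n≤0⇒n≡0 (l0-least 0 refl)
  l-goodBelow : ∀ K k {v} → nth (goodBelow K) k ≡ just v → l (suc k) ≡ v
  l-goodBelow K k e = enumerates 0 l0≡0 (goodBelow-between K) k e
  parity-step : ∀ n → l (suc (suc n)) % 2 ≡ 1 ∸ fib n
  parity-step n with nth-defined (goodBelow (suc (suc n))) (suc n) (goodBelow-length (suc (suc n)))
  ... | v , e = trans (cong (_% 2) (l-goodBelow (suc (suc n)) (suc n) e)) (goodBelow-parity n e)
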